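{- Let $\mathbf{a}=(a_n)_{n\ge1}$ be a sequence over a finite set $\mathcal{A}$. Assume there are integers $\kappa\ge2$ and $n_0\ge1$ such that $p(\mathbf{a},n)\le\kappa n$ for all $n\ge n_0$. Then for each $n\ge n_0$ there exist finite words $U_n,V_n$ and a positive rational number $w_n$ such that: (i) $U_nV_n^{w_n}$ is a prefix of $\mathbf{a}$; (ii) $|U_n|\le2\kappa|V_n|$; (iii) $n/2\le|V_n|\le\kappa n$; (iv) if $U_n$ is nonempty, then the last letters of $U_n$ and $V_n$ are different; (v) $|U_nV_n^{w_n}|/|U_nV_n|\ge1+1/(4\kappa+2)$; (vi) $|U_nV_n|\le(\kappa+1)n-1$; (vii) $|U_n^2V_n|\le(2\kappa+1)n-2$.
   Context: For a finite word $W$, $|W|$ is its length, $W^n$ is the $n$-fold concatenation, and for real $w\ge0$, $W^w=W^{\lfloor w\rfloor}W'$ where $W'$ is the prefix of $W$ of length $\lceil(w-\lfloor w\rfloor)|W|\rceil$. The sequence is identified with the infinite word $a_1a_2\cdots$. The complexity function $p(\mathbf{a},n)$ is the number of distinct words $a_ia_{i+1}\cdots a_{i+n-1}$, $i\ge1$. -}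

module Defs where

open import Data.Nat using (ℕ; zero; suc; _+_; _*_; _≤_)
open import Data.Integer as ℤ using (ℤ; +_; ∣_∣)
open import Data.Rational using (ℚ; floor; ceiling; _/_; _-_) renaming (_*_ to _*ℚ_)
open import Data.Fin using (Fin)
open import Relation.Binary.PropositionalEquality using (_≡_)
open import Data.List using (List; []; _∷_; length; map; take; _++_; replicate; concat)
open import Data.List.Relation.Unary.Unique.Propositional using (Unique)

Word : Set → Set
Word A = List A

-- A sequence a = a₁a₂⋯ is represented 0-indexed: a i is the letter a_{i+1}.
-- factor a i n = a_{i+1} a_{i+2} ⋯ a_{i+n}  (the length-n word starting at position i+1).
factor : {A : Set} → (ℕ → A) → ℕ → ℕ → Word A
factor a i zero    = []
factor a i (suc n) = a i ∷ factor a (suc i) n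

IsPrefix : {A : Set} → Word A → (ℕ → A) → Set
IsPrefix W a = W ≡ factor a 0 (length W)

_^ⁿ_ : {A : Set} → Word A → ℕ → Word A
W ^ⁿ n = concat (replicate n W)

-- W^w for real (here rational) w ≥ 0: W^{⌊w⌋} W' with W' the prefix of W of
-- length ⌈(w - ⌊w⌋)|W|⌉.  (For w ≥ 0, ⌊w⌋ and the ceiling are ≥ 0, so ∣_∣ is exact.)
_^ʳ_ : {A : Set} → Word A → ℚ → Word A
W ^ʳ w = (W ^ⁿ ∣ floor w ∣) ++ take ∣ ceiling ((w - (floor w / 1)) *ℚ ((+ length W) / 1)) ∣ W

-- p(a,n) ≤ m : the set of distinct length-n factors of a has at most m elements,
-- i.e. every family of positions giving pairwise distinct length-n factors has size ≤ m.
ComplexityAtMost : {A : Set} → (ℕ → A) → ℕ → ℕ → Set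
ComplexityAtMost a n m =
  (is : List ℕ) → Unique (map (λ i → factor a i n) is) → length is ≤ m

module Submission where

-- Since p(a,n) ≤ κn, two of the length-n factors starting at positions
-- 0, …, κn coincide, say at i < j ≤ κn; so the window a[i, j+n) has period p = j - i.  Extend
-- this window to the left as long as the period p persists, to a start u ≤ i; then either u = 0
-- or the letter a[u-1] breaks the period.  Replace p by the multiple q = (c+1)p with
-- 2cp < n ≤ 2q: the window minus its last cp letters is still q-periodic.  Taking U = a[0,u),
-- V = a[u,u+q) and w = (length of the q-periodic part)/q, U V^w is a prefix of a, the letters
-- ending U and V differ, and the remaining properties are inequalities between u, q, n and κ.

open import Data.Nat using (ℕ)

module RationalPower where
  open import Data.Nat as ℕ using (zero; suc)
  import Data.Nat.Properties as ℕ
  import Data.Nat.DivMod as ℕ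
  import Data.Nat.Coprimality as Coprimality
  open import Data.Integer as ℤ using (ℤ; +_; -[1+_]) renaming (_+_ to _+ᶻ_; _*_ to _*ᶻ_; -_ to -ᶻ_)
  import Data.Integer.Properties as ℤ
  import Data.Integer.DivMod as ℤ
  open import Data.Integer.Tactic.RingSolver using (solve-∀)
  open import Data.Rational as ℚ using (mkℚ; floor; ceiling; _/_; _-_; toℚᵘ)
  import Data.Rational.Properties as ℚ
  open import Data.Rational.Unnormalised as ℚᵘ using (mkℚᵘ; *≡*; _≃_)
  import Data.Rational.Unnormalised.Properties as ℚᵘ
  open import Data.List using (List; length; take; _++_)
  open import Relation.Binary.PropositionalEquality
  open import Defs using (_^ʳ_; _^ⁿ_)

  quotient-cong : ∀ a b N q → a ℕ.* suc q ≡ N ℕ.* suc b → a ℕ./ suc b ≡ N ℕ./ suc q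
  quotient-cong a b N q eq = begin
      a ℕ./ suc b                          ≡⟨ ℕ.m*n/m*o≡n/o (suc q) a (suc b) ⟨
      (suc q ℕ.* a) ℕ./ (suc q ℕ.* suc b)  ≡⟨ ℕ./-congˡ (trans (ℕ.*-comm (suc q) a) (trans eq (ℕ.*-comm N (suc b)))) ⟩
      (suc b ℕ.* N) ℕ./ (suc q ℕ.* suc b)  ≡⟨ ℕ./-congʳ {m = suc b ℕ.* N} (ℕ.*-comm (suc q) (suc b)) ⟩
      (suc b ℕ.* N) ℕ./ (suc b ℕ.* suc q)  ≡⟨ ℕ.m*n/m*o≡n/o (suc b) N (suc q) ⟩
      N ℕ./ suc q                          ∎
    where open ≡-Reasoning

  floor-fraction : ∀ N q → floor (+ N / suc q) ≡ + (N ℕ./ suc q)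
  floor-fraction N q = go (+ N / suc q) (ℚ.toℚᵘ-fromℚᵘ (mkℚᵘ (+ N) q))
    where
    go : ∀ p → toℚᵘ p ≃ mkℚᵘ (+ N) q → floor p ≡ + (N ℕ./ suc q)
    go (mkℚ (+ a) b _) (*≡* eq) = trans (ℤ.div-pos-is-/ℕ (+ a) (suc b))
      (cong +_ (quotient-cong a b N q (ℤ.+-injective
        (trans (ℤ.pos-* a (suc q)) (trans eq (sym (ℤ.pos-* N (suc b))))))))
    go (mkℚ -[1+ a ] b _) (*≡* eq) with () ← trans eq (sym (ℤ.pos-* N (suc b)))

  fractional-cross-multiplied : ∀ N D R q → N ≡ R ℕ.+ D ℕ.* suc q →
    (+ N *ᶻ + 1 +ᶻ -ᶻ (+ D) *ᶻ + suc q) *ᶻ + suc q *ᶻ + 1 ≡ + R *ᶻ + (suc q ℕ.* 1 ℕ.* 1)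
  fractional-cross-multiplied N D R q N≡R+Dq = begin
      (+ N *ᶻ + 1 +ᶻ -ᶻ (+ D) *ᶻ d) *ᶻ d *ᶻ + 1
    ≡⟨ cong (λ x → (x *ᶻ + 1 +ᶻ -ᶻ (+ D) *ᶻ d) *ᶻ d *ᶻ + 1) N≡R+Dd ⟩
      ((+ R +ᶻ + D *ᶻ d) *ᶻ + 1 +ᶻ -ᶻ (+ D) *ᶻ d) *ᶻ d *ᶻ + 1
    ≡⟨ identity (+ R) (+ D) d ⟩
      + R *ᶻ (d *ᶻ + 1 *ᶻ + 1)
    ≡⟨ cong (+ R *ᶻ_) (trans (cong (_*ᶻ + 1) (ℤ.pos-* (suc q) 1)) (ℤ.pos-* (suc q ℕ.* 1) 1)) ⟨
      + R *ᶻ + (suc q ℕ.* 1 ℕ.* 1)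
    ∎
    where
    open ≡-Reasoning
    d = + suc q
    identity : ∀ (r e d : ℤ) → ((r +ᶻ e *ᶻ d) *ᶻ + 1 +ᶻ -ᶻ e *ᶻ d) *ᶻ d *ᶻ + 1 ≡ r *ᶻ (d *ᶻ + 1 *ᶻ + 1)
    identity = solve-∀
    N≡R+Dd : + N ≡ + R +ᶻ + D *ᶻ d
    N≡R+Dd = trans (cong +_ N≡R+Dq) (trans (ℤ.pos-+ R (D ℕ.* suc q)) (cong (+ R +ᶻ_) (ℤ.pos-* D (suc q))))

  scaled-fractional-part : ∀ N D R q → N ≡ R ℕ.+ D ℕ.* suc q →
    ((+ N / suc q) - (+ D / 1)) ℚ.* (+ suc q / 1) ≡ + R / 1
  scaled-fractional-part N D R q N≡R+Dq = ℚ.toℚᵘ-injective (begin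
      toℚᵘ (((+ N / suc q) - (+ D / 1)) ℚ.* (+ suc q / 1))
    ≈⟨ ℚ.toℚᵘ-homo-* ((+ N / suc q) - (+ D / 1)) (+ suc q / 1) ⟩
      toℚᵘ ((+ N / suc q) - (+ D / 1)) ℚᵘ.* toℚᵘ (+ suc q / 1)
    ≈⟨ ℚᵘ.*-congʳ (ℚᵘ.≃-trans (ℚ.toℚᵘ-homo-+ (+ N / suc q) (ℚ.- (+ D / 1)))
                               (ℚᵘ.+-congʳ (toℚᵘ (+ N / suc q)) (ℚ.toℚᵘ-homo‿- (+ D / 1)))) ⟩
      (toℚᵘ (+ N / suc q) ℚᵘ.+ ℚᵘ.- toℚᵘ (+ D / 1)) ℚᵘ.* toℚᵘ (+ suc q / 1)
    ≈⟨ ℚᵘ.*-cong (ℚᵘ.+-cong (ℚ.toℚᵘ-fromℚᵘ (mkℚᵘ (+ N) q)) (ℚᵘ.-‿cong (ℚ.toℚᵘ-fromℚᵘ (mkℚᵘ (+ D) 0))))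
                 (ℚ.toℚᵘ-fromℚᵘ (mkℚᵘ (+ suc q) 0)) ⟩
      (mkℚᵘ (+ N) q ℚᵘ.+ ℚᵘ.- mkℚᵘ (+ D) 0) ℚᵘ.* mkℚᵘ (+ suc q) 0
    ≈⟨ *≡* (fractional-cross-multiplied N D R q N≡R+Dq) ⟩
      mkℚᵘ (+ R) 0
    ≈⟨ ℚ.toℚᵘ-fromℚᵘ (mkℚᵘ (+ R) 0) ⟨
      toℚᵘ (+ R / 1)
    ∎)
    where open ℚᵘ.≃-Reasoning

  ceiling-natural : ∀ R → ceiling (+ R / 1) ≡ + R
  ceiling-natural R rewrite ℚ.normalize-coprime {R} {0} (Coprimality.sym (Coprimality.1-coprimeTo R)) = go R
    where
    negative-/1 : ∀ r → -[1+ r ] ℤ./ℕ 1 ≡ -[1+ r ]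
    negative-/1 r with suc r ℕ.% 1 | ℕ.n%1≡0 (suc r)
    ... | .0 | refl = cong (λ x → -ᶻ (+ x)) (ℕ.n/1≡n (suc r))
    go : ∀ R → ceiling (mkℚ (+ R) 0 (Coprimality.sym (Coprimality.1-coprimeTo R))) ≡ + R
    go zero    = refl
    go (suc r) = cong -ᶻ_ (trans (ℤ.div-pos-is-/ℕ -[1+ r ] 1) (negative-/1 r))

  power-fraction : ∀ {A : Set} (V : List A) q N → length V ≡ suc q →
    V ^ʳ (+ N / suc q) ≡ (V ^ⁿ (N ℕ./ suc q)) ++ take (N ℕ.% suc q) V
  power-fraction V q N |V|≡q+1
    rewrite |V|≡q+1 | floor-fraction N q
          | scaled-fractional-part N (N ℕ./ suc q) (N ℕ.% suc q) q (ℕ.m≡m%n+[m/n]*n N (suc q))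
          | ceiling-natural (N ℕ.% suc q) = refl

module Periodicity {A : Set} (a : ℕ → A) where
  open import Data.Nat hiding (_/_)
  open import Data.Nat using () renaming (_/_ to _div_)
  open import Data.Nat.Properties
  open import Data.Nat.DivMod using (m≡m%n+[m/n]*n; m%n<n)
  open import Data.Nat.Tactic.RingSolver using (solve-∀)
  open import Data.Integer using (+_)
  open import Data.Rational using (_/_)
  open import Data.List using (_∷_; length; take; _++_; last)
  open import Data.List.Properties using (++-assoc; ∷-injectiveˡ; ∷-injectiveʳ)
  open import Data.Maybe using (just)
  import Data.Maybe.Properties as Maybe
  open import Relation.Nullary using (yes; no)
  open import Relation.Binary.Definitions using (DecidableEquality)
  open import Relation.Binary.PropositionalEquality
  open import Defs using (factor; IsPrefix; _^ⁿ_; _^ʳ_)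
  open RationalPower using (power-fraction)

  -- Throughout, a[i, i+n) denotes the factor `factor a i n`.
  factor-length : ∀ i n → length (factor a i n) ≡ n
  factor-length i zero    = refl
  factor-length i (suc n) = cong suc (factor-length (suc i) n)

  factor-prefix : ∀ {W} L → W ≡ factor a 0 L → IsPrefix W a
  factor-prefix {W} L W≡ = trans W≡ (cong (factor a 0) (sym (trans (cong length W≡) (factor-length 0 L))))

  factor-++ : ∀ i m n → factor a i (m + n) ≡ factor a i m ++ factor a (i + m) n
  factor-++ i zero    n = cong (λ x → factor a x n) (sym (+-identityʳ i))
  factor-++ i (suc m) n = cong (a i ∷_)
    (trans (factor-++ (suc i) m n) (cong (λ x → factor a (suc i) m ++ factor a x n) (sym (+-suc i m))))

  factor-cong : ∀ i j n → (∀ t → t < n → a (i + t) ≡ a (j + t)) → factor a i n ≡ factor a j n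
  factor-cong i j zero    _     = refl
  factor-cong i j (suc n) agree = cong₂ _∷_
    (subst₂ (λ x y → a x ≡ a y) (+-identityʳ i) (+-identityʳ j) (agree 0 z<s))
    (factor-cong (suc i) (suc j) n λ t t<n →
      subst₂ (λ x y → a x ≡ a y) (+-suc i t) (+-suc j t) (agree (suc t) (s<s t<n)))

  factor-letters : ∀ i j n → factor a i n ≡ factor a j n → ∀ t → t < n → a (i + t) ≡ a (j + t)
  factor-letters i j (suc n) eq zero    _         =
    subst₂ (λ x y → a x ≡ a y) (sym (+-identityʳ i)) (sym (+-identityʳ j)) (∷-injectiveˡ eq)
  factor-letters i j (suc n) eq (suc t) (s<s t<n) =
    subst₂ (λ x y → a x ≡ a y) (sym (+-suc i t)) (sym (+-suc j t))
      (factor-letters (suc i) (suc j) n (∷-injectiveʳ eq) t t<n)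

  take-factor : ∀ i r n → r ≤ n → take r (factor a i n) ≡ factor a i r
  take-factor i zero    n       _         = refl
  take-factor i (suc r) (suc n) (s≤s r≤n) = cong (a i ∷_) (take-factor (suc i) r n r≤n)

  last-factor : ∀ i m → last (factor a i (suc m)) ≡ just (a (i + m))
  last-factor i zero    = cong (λ x → just (a x)) (sym (+-identityʳ i))
  last-factor i (suc m) = trans (last-factor (suc i) m) (cong (λ x → just (a x)) (sym (+-suc i m)))

  -- The window a[i, i+E+p) has period p: every letter in its first E positions recurs p later.
  HasPeriod : ℕ → ℕ → ℕ → Set
  HasPeriod i p E = ∀ t → t < E → a (i + t) ≡ a (i + t + p)

  repetition-period : ∀ i p n → factor a i n ≡ factor a (i + p) n → HasPeriod i p n
  repetition-period i p n rep t t<n =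
    trans (factor-letters i (i + p) n rep t t<n) (cong a (+-comm-middle i p t))
    where
    +-comm-middle : ∀ i p t → i + p + t ≡ i + t + p
    +-comm-middle = solve-∀

  period-multiple-at : ∀ {i p E} → HasPeriod i p E → ∀ c t → t + c * p < E + p →
    a (i + t) ≡ a (i + t + c * p)
  period-multiple-at {i} {p} {E} per zero    t _ = cong a (sym (+-identityʳ (i + t)))
  period-multiple-at {i} {p} {E} per (suc c) t t+cp+p<E+p = begin
      a (i + t)               ≡⟨ period-multiple-at per c t (≤-<-trans (+-monoʳ-≤ t (m≤n+m (c * p) p)) t+cp+p<E+p) ⟩
      a (i + t + c * p)       ≡⟨ cong a (+-assoc i t (c * p)) ⟩
      a (i + (t + c * p))     ≡⟨ per (t + c * p) t+cp<E ⟩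
      a (i + (t + c * p) + p) ≡⟨ cong a (regroup i t c p) ⟩
      a (i + t + suc c * p)   ∎
    where
    open ≡-Reasoning
    regroup : ∀ i t c p → i + (t + c * p) + p ≡ i + t + (p + c * p)
    regroup = solve-∀
    move-p : ∀ t c p → t + (p + c * p) ≡ t + c * p + p
    move-p = solve-∀
    t+cp<E : t + c * p < E
    t+cp<E = +-cancelʳ-< p (t + c * p) E (subst (_< E + p) (move-p t c p) t+cp+p<E+p)

  period-multiple : ∀ {i p E} c → HasPeriod i p (c * p + E) → HasPeriod i (suc c * p) E
  period-multiple {i} {p} {E} c per t t<E = period-multiple-at per (suc c) t
    (subst₂ _<_ (sym (shuffleˡ t c p)) (sym (shuffleʳ E c p)) (+-monoˡ-< (c * p + p) t<E))
    where
    shuffleˡ : ∀ t c p → t + (p + c * p) ≡ t + (c * p + p)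
    shuffleˡ = solve-∀
    shuffleʳ : ∀ E c p → c * p + E + p ≡ E + (c * p + p)
    shuffleʳ = solve-∀

  period-shift : ∀ {i q E} → HasPeriod i q E → ∀ m → m ≤ E → factor a i m ≡ factor a (i + q) m
  period-shift {i} {q} per m m≤E = factor-cong i (i + q) m λ t t<m →
    trans (per t (<-≤-trans t<m m≤E)) (cong a (+-comm-middle i t q))
    where
    +-comm-middle : ∀ i t q → i + t + q ≡ i + q + t
    +-comm-middle = solve-∀

  power-prefix : ∀ {i q E} → HasPeriod i q E → ∀ c r → r ≤ q → c * q + r ≤ q + E →
    (factor a i q ^ⁿ c) ++ take r (factor a i q) ≡ factor a i (c * q + r)
  power-prefix {i} {q} {E} per zero    r r≤q _     = take-factor i r q r≤q
  power-prefix {i} {q} {E} per (suc c) r r≤q bound = begin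
      (V ++ (V ^ⁿ c)) ++ take r V    ≡⟨ ++-assoc V (V ^ⁿ c) (take r V) ⟩
      V ++ ((V ^ⁿ c) ++ take r V)    ≡⟨ cong (V ++_) (power-prefix per c r r≤q (≤-trans rest≤E (m≤n+m E q))) ⟩
      V ++ factor a i (c * q + r)     ≡⟨ cong (V ++_) (period-shift per (c * q + r) rest≤E) ⟩
      V ++ factor a (i + q) (c * q + r) ≡⟨ factor-++ i q (c * q + r) ⟨
      factor a i (q + (c * q + r))    ≡⟨ cong (factor a i) (+-assoc q (c * q) r) ⟨
      factor a i (suc c * q + r)      ∎
    where
    open ≡-Reasoning
    V = factor a i q
    rest≤E : c * q + r ≤ E
    rest≤E = +-cancelˡ-≤ q (c * q + r) E (subst (_≤ q + E) (+-assoc q (c * q) r) bound)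

  PeriodBreaksBefore : ℕ → ℕ → Set
  PeriodBreaksBefore i p = ∀ j → i ≡ suc j → a j ≢ a (j + p)

  record LeftMaximalExtension (i p E : ℕ) : Set where
    field
      start extra       : ℕ
      start+extra≡i     : start + extra ≡ i
      periodic          : HasPeriod start p (extra + E)
      maximal           : PeriodBreaksBefore start p

  extend-left : DecidableEquality A → ∀ i p E → HasPeriod i p E → LeftMaximalExtension i p E
  extend-left _≟_ zero    p E per = record
    { start = 0 ; extra = 0 ; start+extra≡i = refl ; periodic = per ; maximal = λ _ () }
  extend-left _≟_ (suc i) p E per with a i ≟ a (i + p)
  ... | no  breaks = record
    { start = suc i ; extra = 0 ; start+extra≡i = +-identityʳ (suc i) ; periodic = per
    ; maximal = λ { _ refl → breaks } }
  ... | yes continues = record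
    { start = start ; extra = suc extra ; start+extra≡i = trans (+-suc start extra) (cong suc start+extra≡i)
    ; periodic = subst (HasPeriod start p) (+-suc extra E) periodic ; maximal = maximal }
    where
    longer : HasPeriod i p (suc E)
    longer zero    _         = subst₂ (λ x y → a x ≡ a (y + p)) (sym (+-identityʳ i)) (sym (+-identityʳ i)) continues
    longer (suc t) (s<s t<E) = subst₂ (λ x y → a x ≡ a (y + p)) (sym (+-suc i t)) (sym (+-suc i t)) (per t t<E)
    open LeftMaximalExtension (extend-left _≟_ i p (suc E) longer)

  boundary-letters-differ : ∀ u p' q' → PeriodBreaksBefore u (suc p') → a (u + p') ≡ a (u + q') →
    ∀ x y → last (factor a 0 u) ≡ just x → last (factor a u (suc q')) ≡ just y → x ≢ y
  boundary-letters-differ (suc j) p' q' breaks same x y lastU lastV x≡y = breaks j refl (begin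
      a j            ≡⟨ Maybe.just-injective (trans (sym (last-factor 0 j)) lastU) ⟩
      x              ≡⟨ x≡y ⟩
      y              ≡⟨ Maybe.just-injective (trans (sym lastV) (last-factor (suc j) q')) ⟩
      a (suc j + q') ≡⟨ same ⟨
      a (suc j + p') ≡⟨ cong a (+-suc j p') ⟨
      a (j + suc p') ∎)
    where open ≡-Reasoning

  periodic-prefix : ∀ u q' E → HasPeriod u (suc q') E →
    factor a 0 u ++ (factor a u (suc q') ^ʳ (+ (suc q' + E) / suc q')) ≡ factor a 0 (u + (suc q' + E))
  periodic-prefix u q' E per = begin
      U ++ (V ^ʳ (+ N / q))                     ≡⟨ cong (U ++_) (power-fraction V q' N (factor-length u q)) ⟩
      U ++ ((V ^ⁿ (N div q)) ++ take (N % q) V) ≡⟨ cong (U ++_) (power-prefix per (N div q) (N % q) (<⇒≤ (m%n<n N q)) (≤-reflexive N≡)) ⟩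
      U ++ factor a u (N div q * q + N % q)     ≡⟨ cong (λ m → U ++ factor a u m) N≡ ⟩
      U ++ factor a u N                         ≡⟨ factor-++ 0 u N ⟨
      factor a 0 (u + N)                        ∎
    where
    open ≡-Reasoning
    q = suc q'
    N = q + E
    U = factor a 0 u
    V = factor a u q
    N≡ : N div q * q + N % q ≡ N
    N≡ = trans (+-comm (N div q * q) (N % q)) (sym (m≡m%n+[m/n]*n N q))

module Counting where
  open import Data.Nat
  open import Data.Nat.Properties
  open import Data.List using (length; map; downFrom)
  open import Data.List.Properties using (length-downFrom; ≡-dec)
  open import Data.List.Relation.Unary.All using (All; []; _∷_)
  open import Data.List.Relation.Unary.AllPairs using ([]; _∷_)
  open import Data.List.Relation.Unary.Unique.Propositional using (Unique)
  open import Data.Product using (Σ-syntax; _×_; _,_)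
  open import Data.Sum using (_⊎_; inj₁; inj₂)
  open import Relation.Nullary using (yes; no; contradiction)
  open import Relation.Binary.Definitions using (DecidableEquality)
  open import Relation.Binary.PropositionalEquality
  open import Defs using (factor; ComplexityAtMost)

  module FirstRepetition {B : Set} (_≟_ : DecidableEquality B) (f : ℕ → B) where

    occurs-or-absent : ∀ m x → (Σ[ i ∈ ℕ ] i < m × x ≡ f i) ⊎ All (x ≢_) (map f (downFrom m))
    occurs-or-absent zero    x = inj₂ []
    occurs-or-absent (suc m) x with x ≟ f m | occurs-or-absent m x
    ... | yes x≡fm | _                    = inj₁ (m , ≤-refl , x≡fm)
    ... | no  _    | inj₁ (i , i<m , x≡fi) = inj₁ (i , m<n⇒m<1+n i<m , x≡fi)
    ... | no  x≢fm | inj₂ absent          = inj₂ (x≢fm ∷ absent)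

    repeat-or-distinct : ∀ m → (Σ[ i ∈ ℕ ] Σ[ j ∈ ℕ ] i < j × j < m × f i ≡ f j) ⊎ Unique (map f (downFrom m))
    repeat-or-distinct zero = inj₂ []
    repeat-or-distinct (suc m) with repeat-or-distinct m | occurs-or-absent m (f m)
    ... | inj₁ (i , j , i<j , j<m , fi≡fj) | _                    = inj₁ (i , j , i<j , m<n⇒m<1+n j<m , fi≡fj)
    ... | inj₂ _                           | inj₁ (i , i<m , fm≡fi) = inj₁ (i , m , i<m , ≤-refl , sym fm≡fi)
    ... | inj₂ distinct                    | inj₂ absent          = inj₂ (absent ∷ distinct)

    pigeonhole : ∀ M → (∀ is → Unique (map f is) → length is ≤ M) →
      Σ[ i ∈ ℕ ] Σ[ j ∈ ℕ ] i < j × j ≤ M × f i ≡ f j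
    pigeonhole M bounded with repeat-or-distinct (suc M)
    ... | inj₁ (i , j , i<j , s≤s j≤M , fi≡fj) = i , j , i<j , j≤M , fi≡fj
    ... | inj₂ distinct = contradiction
      (subst (_≤ M) (length-downFrom (suc M)) (bounded (downFrom (suc M)) distinct)) (<-irrefl refl)
  repeated-factor : {A : Set} → DecidableEquality A → (a : ℕ → A) → ∀ n M → ComplexityAtMost a n M →
    Σ[ i ∈ ℕ ] Σ[ j ∈ ℕ ] i < j × j ≤ M × factor a i n ≡ factor a j n
  repeated-factor _≟_ a n M = FirstRepetition.pigeonhole (≡-dec _≟_) (λ i → factor a i n) M


module Arithmetic where
  open import Data.Nat hiding (_/_)
  open import Data.Nat.Properties
  open import Data.Nat.DivMod using (_/_; _%_; m≡m%n+[m/n]*n; m%n<n)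
  open import Data.Nat.Tactic.RingSolver using (solve-∀)
  open import Data.Sum using (_⊎_; inj₁; inj₂)
  open import Relation.Binary.PropositionalEquality

  record HalfLengthMultiple (p n : ℕ) : Set where
    field
      c         : ℕ
      2cp<n     : c * p + c * p < n
      n≤2[c+1]p : n ≤ suc c * p + suc c * p

  -- Such a multiple exists for every period p ≥ 1 and n ≥ 1: take c = ⌊(n-1)/2p⌋.
  choose-multiple : ∀ p' n → 1 ≤ n → HalfLengthMultiple (suc p') n
  choose-multiple p' (suc n) _ = record { c = c ; 2cp<n = lower ; n≤2[c+1]p = upper }
    where
    p = suc p'
    c = n / (p + p)
    r = n % (p + p)
    n≡r+c2p : n ≡ r + c * (p + p)
    n≡r+c2p = m≡m%n+[m/n]*n n (p + p)
    double : ∀ c p → c * (p + p) ≡ c * p + c * p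
    double = solve-∀
    double-suc : ∀ c p → (p + p) + c * (p + p) ≡ (p + c * p) + (p + c * p)
    double-suc = solve-∀
    lower : c * p + c * p < suc n
    lower = s≤s (subst₂ _≤_ (double c p) (sym n≡r+c2p) (m≤n+m (c * (p + p)) r))
    upper : suc n ≤ suc c * p + suc c * p
    upper = subst₂ _≤_ (cong suc (sym n≡r+c2p)) (double-suc c p) (+-monoˡ-≤ (c * (p + p)) (m%n<n n (p + p)))

  multiple-cases : ∀ c p n → c * p + c * p < n → (suc c * p ≡ p) ⊎ (suc c * p < n)
  multiple-cases zero    p n _      = inj₁ (+-identityʳ p)
  multiple-cases (suc c) p n 2cp<n = inj₂ (≤-<-trans (+-monoˡ-≤ (suc c * p) (m≤m+n p (c * p))) 2cp<n)

  more-than-half : ∀ X L n → X + X < n → n ≤ L → n < (L ∸ X) + (L ∸ X)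
  more-than-half X L n 2X<n n≤L = +-cancelʳ-< (X + X) n ((L ∸ X) + (L ∸ X)) (begin-strict
      n + (X + X)                   <⟨ +-monoʳ-< n 2X<n ⟩
      n + n                         ≤⟨ +-mono-≤ n≤L n≤L ⟩
      L + L                         ≡⟨ cong₂ _+_ L≡ L≡ ⟩
      (L ∸ X + X) + (L ∸ X + X)     ≡⟨ regroup (L ∸ X) X ⟩
      (L ∸ X) + (L ∸ X) + (X + X)   ∎)
    where
    open ≤-Reasoning
    L≡ : L ≡ L ∸ X + X
    L≡ = sym (m∸n+n≡m (≤-trans (≤-trans (m≤m+n X X) (<⇒≤ 2X<n)) n≤L))
    regroup : ∀ y X → (y + X) + (y + X) ≡ (y + y) + (X + X)
    regroup = solve-∀

  -- Numerical bounds on u = |U|, q = |V| and u + q + e = |U V^w| in terms of κ and n.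
  module LengthBounds (κ n u q : ℕ) where

    Fits : Set
    Fits = (u + q ≤ κ * n) ⊎ (q < n)

    expand-κ+1 : κ * n + n ≡ (κ + 1) * n
    expand-κ+1 = expand κ n
      where
      expand : ∀ κ n → κ * n + n ≡ (κ + 1) * n
      expand = solve-∀

    expand-2κ+1 : κ * n + κ * n + n ≡ (2 * κ + 1) * n
    expand-2κ+1 = expand κ n
      where
      expand : ∀ κ n → κ * n + κ * n + n ≡ (2 * κ + 1) * n
      expand = solve-∀

    V-bound : 1 ≤ κ → Fits → q ≤ κ * n
    V-bound κ≥1 (inj₁ UV-fits) = ≤-trans (m≤n+m q u) UV-fits
    V-bound κ≥1 (inj₂ q<n)     = ≤-trans (<⇒≤ q<n) (m≤n*m n κ {{>-nonZero κ≥1}})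

    U-bound : u ≤ κ * n → n ≤ q + q → u ≤ 2 * κ * q
    U-bound u≤κn n≤2q = ≤-trans u≤κn (≤-trans (*-monoʳ-≤ κ n≤2q) (≤-reflexive (double κ q)))
      where
      double : ∀ κ q → κ * (q + q) ≡ 2 * κ * q
      double = solve-∀

    -- Property (v): |U V^w| / |U V| ≥ 1 + 1/(4κ+2), cleared of denominators, when the excess e exceeds n/2.
    exponent-bound : ∀ e → u ≤ κ * n → q ≤ κ * n → n < e + e →
      (u + q) * (4 * κ + 3) ≤ (u + (q + e)) * (4 * κ + 2)
    exponent-bound e u≤κn q≤κn n<2e = begin
        (u + q) * (4 * κ + 3)                       ≡⟨ split (u + q) κ ⟩
        (u + q) * (4 * κ + 2) + (u + q)             ≤⟨ +-monoʳ-≤ ((u + q) * (4 * κ + 2)) UV≤ ⟩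
        (u + q) * (4 * κ + 2) + e * (4 * κ + 2)     ≡⟨ regroup u q e κ ⟩
        (u + (q + e)) * (4 * κ + 2)                 ∎
      where
      open ≤-Reasoning
      split : ∀ m κ → m * (4 * κ + 3) ≡ m * (4 * κ + 2) + m
      split = solve-∀
      regroup : ∀ u q e κ → (u + q) * (4 * κ + 2) + e * (4 * κ + 2) ≡ (u + (q + e)) * (4 * κ + 2)
      regroup = solve-∀
      twice : ∀ κ n → κ * n + κ * n ≡ n * (κ + κ)
      twice = solve-∀
      expand : ∀ e κ → (e + e) * (κ + κ) + (e + e) ≡ e * (4 * κ + 2)
      expand = solve-∀
      UV≤ : u + q ≤ e * (4 * κ + 2)
      UV≤ = begin
        u + q                               ≤⟨ +-mono-≤ u≤κn q≤κn ⟩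
        κ * n + κ * n                       ≡⟨ twice κ n ⟩
        n * (κ + κ)                         ≤⟨ *-monoˡ-≤ (κ + κ) (<⇒≤ n<2e) ⟩
        (e + e) * (κ + κ)                   ≤⟨ m≤m+n ((e + e) * (κ + κ)) (e + e) ⟩
        (e + e) * (κ + κ) + (e + e)         ≡⟨ expand e κ ⟩
        e * (4 * κ + 2)                     ∎

    UV-bound : suc u ≤ κ * n → Fits → 1 ≤ n → u + q + 1 ≤ (κ + 1) * n
    UV-bound u<κn (inj₁ UV-fits) n≥1 = subst (u + q + 1 ≤_) expand-κ+1 (+-mono-≤ UV-fits n≥1)
    UV-bound u<κn (inj₂ q<n)     _   =
      ≤-trans (n≤1+n _) (subst₂ _≤_ (regroup u q) expand-κ+1 (+-mono-≤ u<κn q<n))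
      where
      regroup : ∀ u q → suc u + suc q ≡ suc (u + q + 1)
      regroup = solve-∀

    UUV-bound : suc u ≤ κ * n → Fits → 1 ≤ n → u + (u + q) + 2 ≤ (2 * κ + 1) * n
    UUV-bound u<κn (inj₁ UV-fits) n≥1 =
      subst₂ _≤_ (regroup u q) expand-2κ+1 (+-mono-≤ (+-mono-≤ u<κn UV-fits) n≥1)
      where
      regroup : ∀ u q → suc u + (u + q) + 1 ≡ u + (u + q) + 2
      regroup = solve-∀
    UUV-bound u<κn (inj₂ q<n)     _   =
      subst₂ _≤_ (regroup u q) expand-2κ+1 (+-mono-≤ (+-mono-≤ u<κn u<κn) (<⇒≤ q<n))
      where
      regroup : ∀ u q → suc u + suc u + q ≡ u + (u + q) + 2
      regroup = solve-∀

module Construction where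
  open import Data.Nat hiding (_/_)
  open import Data.Nat.Properties
  open import Data.Integer using (+_)
  open import Data.Rational using (ℚ; 0ℚ; _/_) renaming (_<_ to _<ℚ_)
  import Data.Rational.Properties as ℚ
  open import Data.List using (List; []; _++_; length; last)
  open import Data.List.Properties using (length-++)
  open import Data.Maybe using (just)
  open import Data.Product using (Σ; _×_; _,_)
  open import Data.Sum as Sum using (_⊎_; inj₁; inj₂)
  open import Relation.Binary.Definitions using (DecidableEquality)
  open import Relation.Binary.PropositionalEquality
  open import Defs

  PrefixPowerDecomposition : {A : Set} → (ℕ → A) → ℕ → ℕ → Set
  PrefixPowerDecomposition {A} a κ n =
    Σ (List A) λ U → Σ (List A) λ V → Σ ℚ λ w →
      (0ℚ <ℚ w)
      × IsPrefix (U ++ (V ^ʳ w)) a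
      × length U ≤ 2 * κ * length V
      × (n ≤ 2 * length V × length V ≤ κ * n)
      × (U ≢ [] → ∀ x y → last U ≡ just x → last V ≡ just y → x ≢ y)
      × (length (U ++ V) * (4 * κ + 3) ≤ length (U ++ (V ^ʳ w)) * (4 * κ + 2))
      × (length (U ++ V) + 1 ≤ (κ + 1) * n)
      × (length (U ++ U ++ V) + 2 ≤ (2 * κ + 1) * n)

  module _ {A : Set} (_≟_ : DecidableEquality A) (a : ℕ → A) where
    open Periodicity a
    open Arithmetic

    record PeriodicWindow (j n : ℕ) : Set where
      field
        u q' e   : ℕ
        u<j      : u < j
        periodic : HasPeriod u (suc q') e
        boundary : ∀ x y → last (factor a 0 u) ≡ just x → last (factor a u (suc q')) ≡ just y → x ≢ y
        n≤2q     : n ≤ suc q' + suc q'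
        n<2e     : n < e + e
        fits     : (u + suc q' ≤ j) ⊎ (suc q' < n)

    -- A length-n factor occurring at positions i < j yields such a window: take the period
    -- p = j - i, extend its window left-maximally, and pass to the multiple q = (c+1)p.
    window-from-repetition : ∀ i j n → 1 ≤ n → i < j → factor a i n ≡ factor a j n → PeriodicWindow j n
    window-from-repetition i j n n≥1 i<j rep = record
      { u = u ; q' = p' + c * p ; e = e ; u<j = <-≤-trans (s≤s u≤i) i<j ; periodic = period-q
      ; boundary = boundary-letters-differ u p' (p' + c * p) maximal period-ends
      ; n≤2q = n≤2[c+1]p ; n<2e = more-than-half (c * p) (s + n) n 2cp<n (m≤n+m n s) ; fits = fits }
      where
      p' = j ∸ suc i
      p  = suc p'
      i+p≡j : i + p ≡ j
      i+p≡j = trans (+-suc i p') (m+[n∸m]≡n i<j)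
      period-p : HasPeriod i p n
      period-p = repetition-period i p n (subst (λ x → factor a i n ≡ factor a x n) (sym i+p≡j) rep)
      open LeftMaximalExtension (extend-left _≟_ i p n period-p) renaming (start to u; extra to s)
      open HalfLengthMultiple (choose-multiple p' n n≥1)
      e = s + n ∸ c * p
      u≤i : u ≤ i
      u≤i = subst (u ≤_) start+extra≡i (m≤m+n u s)
      cp≤s+n : c * p ≤ s + n
      cp≤s+n = ≤-trans (≤-trans (m≤m+n (c * p) (c * p)) (<⇒≤ 2cp<n)) (m≤n+m n s)
      period-q : HasPeriod u (suc c * p) e
      period-q = period-multiple c (subst (HasPeriod u p) (sym (m+[n∸m]≡n cp≤s+n)) periodic)
      -- a[u+q-1] = a[u-1+p]: the last letter of V is the letter that a[u-1] fails to match.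
      period-ends : a (u + p') ≡ a (u + (p' + c * p))
      period-ends = trans (period-multiple-at periodic c p' p'+cp<s+n+p) (cong a (+-assoc u p' (c * p)))
        where
        p'+cp<s+n+p : p' + c * p < s + n + p
        p'+cp<s+n+p = ≤-trans (≤-reflexive (trans (cong suc (+-comm p' (c * p))) (sym (+-suc (c * p) p'))))
                                (+-monoˡ-≤ p cp≤s+n)
      fits : (u + suc c * p ≤ j) ⊎ (suc c * p < n)
      fits with multiple-cases c p n 2cp<n
      ... | inj₁ q≡p = inj₁ (≤-trans (+-mono-≤ u≤i (≤-reflexive q≡p)) (≤-reflexive i+p≡j))
      ... | inj₂ q<n = inj₂ q<n

    decomposition : ∀ κ n {j} → 2 ≤ κ → 1 ≤ n → j ≤ κ * n → PeriodicWindow j n →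
      PrefixPowerDecomposition a κ n
    decomposition κ n κ≥2 n≥1 j≤κn window =
      U , V , w , w>0 , factor-prefix (u + (q + e)) UVʷ≡
        , subst₂ (λ x y → x ≤ 2 * κ * y) (sym |U|) (sym |V|) (U-bound (<⇒≤ u<κn) n≤2q)
        , (subst (λ y → n ≤ 2 * y) (sym |V|) (subst (n ≤_) (double q) n≤2q)
        , subst (_≤ κ * n) (sym |V|) q≤κn)
        , (λ _ → boundary)
        , subst₂ (λ x y → x * (4 * κ + 3) ≤ y * (4 * κ + 2)) (sym |UV|) (sym |UVʷ|)
            (exponent-bound e (<⇒≤ u<κn) q≤κn n<2e)
        , subst (λ x → x + 1 ≤ (κ + 1) * n) (sym |UV|) (UV-bound u<κn fits′ n≥1)
        , subst (λ x → x + 2 ≤ (2 * κ + 1) * n) (sym |UUV|) (UUV-bound u<κn fits′ n≥1)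
      where
      open PeriodicWindow window
      q = suc q'
      U = factor a 0 u
      V = factor a u q
      w = + (q + e) / q
      UVʷ≡ : U ++ (V ^ʳ w) ≡ factor a 0 (u + (q + e))
      UVʷ≡ = periodic-prefix u q' e periodic
      w>0 : 0ℚ <ℚ w
      w>0 = ℚ.positive⁻¹ w {{ℚ.normalize-pos (q + e) q}}
      |U| : length U ≡ u
      |U| = factor-length 0 u
      |V| : length V ≡ q
      |V| = factor-length u q
      |UV| : length (U ++ V) ≡ u + q
      |UV| = trans (length-++ U) (cong₂ _+_ |U| |V|)
      |UUV| : length (U ++ U ++ V) ≡ u + (u + q)
      |UUV| = trans (length-++ U) (cong₂ _+_ |U| |UV|)
      |UVʷ| : length (U ++ (V ^ʳ w)) ≡ u + (q + e)
      |UVʷ| = trans (cong length UVʷ≡) (factor-length 0 (u + (q + e)))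
      double : ∀ q → q + q ≡ 2 * q
      double q = cong (λ x → q + x) (sym (+-identityʳ q))
      open LengthBounds κ n u q
      u<κn : suc u ≤ κ * n
      u<κn = <-≤-trans u<j j≤κn
      fits′ : Fits
      fits′ = Sum.map₁ (λ UV≤j → ≤-trans UV≤j j≤κn) fits
      q≤κn : q ≤ κ * n
      q≤κn = V-bound (≤-trans (s≤s z≤n) κ≥2) fits′

open import Defs
open import Data.Nat using (ℕ; _+_; _*_; _≤_)
open import Data.Fin using (Fin)
open import Data.List using (List; []; _++_; length; last)
open import Data.Maybe using (just)
open import Data.Rational using (ℚ; 0ℚ; _<_)
open import Data.Product using (Σ; _×_; ∃; _,_)
open import Relation.Binary.PropositionalEquality using (_≡_; _≢_)
import Data.Nat.Properties as ℕ
import Data.Fin.Properties as Fin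
open Counting using (repeated-factor)
open Construction using (window-from-repetition; decomposition)

lemma7p1 : (k : ℕ) (a : ℕ → Fin k) (κ n₀ : ℕ) → 2 ≤ κ → 1 ≤ n₀ →
    ((n : ℕ) → n₀ ≤ n → ComplexityAtMost a n (κ * n)) →
    (n : ℕ) → n₀ ≤ n →
    Σ (List (Fin k)) λ U → Σ (List (Fin k)) λ V → Σ ℚ λ w →
    (0ℚ < w)
    × IsPrefix (U ++ (V ^ʳ w)) a
    × length U ≤ 2 * κ * length V
    × (n ≤ 2 * length V × length V ≤ κ * n)
    × (U ≢ [] → ∀ x y → last U ≡ just x → last V ≡ just y → x ≢ y)
    × (length (U ++ V) * (4 * κ + 3) ≤ length (U ++ (V ^ʳ w)) * (4 * κ + 2))
    × (length (U ++ V) + 1 ≤ (κ + 1) * n)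
    × (length (U ++ U ++ V) + 2 ≤ (2 * κ + 1) * n)
lemma7p1 k a κ n₀ κ≥2 n₀≥1 complexity n n₀≤n
  with i , j , i<j , j≤κn , repeated ← repeated-factor Fin._≟_ a n (κ * n) (complexity n n₀≤n)
  = decomposition Fin._≟_ a κ n κ≥2 n≥1 j≤κn (window-from-repetition Fin._≟_ a i j n n≥1 i<j repeated)
  where
  n≥1 : 1 ≤ n
  n≥1 = ℕ.≤-trans n₀≥1 n₀≤n
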